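{- (a) Let $T$ be a universal first-order theory in a language with no function symbols of arity $\geq 2$. Then $T$ has APU if and only if $T$ has AP; $T$ has SAPU if and only if $T$ has SAP; and, for any binary relation symbol $R$ of the language, $T$ has superSAPU with respect to $R$ if and only if $T$ has superSAP with respect to $R$. (b) More generally, let $\mathcal{K}$ be a class of structures for a language with no function symbols of arity $\geq 2$, and suppose $\mathcal{K}$ is closed under taking substructures. Then $\mathcal{K}$ has APU iff it has AP; it has SAPU iff it has SAP; and it has superSAPU with respect to a binary relation symbol $R$ iff it has superSAP with respect to $R$. (c) For any language, the class of all structures for that language (i.e., the theory with no nonlogical axioms) has SAPU, and, for any binary relation symbol $R$ in the language, it has superSAPU with respect to $R$.
   Context: Structures are first-order structures (relation, function and constant symbols; equality interpreted as identity). An embedding $\iota:\mathbf A\to\mathbf B$ is an injective map preserving constants and functions and such that $R^{\mathbf A}(a_1,\dots)$ holds iff $R^{\mathbf B}(\iota a_1,\dots)$ holds, for every relation symbol $R$. $\mathbf A\subseteq\mathbf B$ ($\mathbf A$ is a substructure of $\mathbf B$) means $A\subseteq B$ and the inclusion is an embedding. All classes are closed under isomorphism. A class $\mathcal K$ has the amalgamation property (AP) if whenever $\mathbf A,\mathbf B,\mathbf C\in\mathcal K$ and $\iota_1:\mathbf C\to\mathbf A$, $\iota_2:\mathbf C\to\mathbf B$ are embeddings, there are $\mathbf D\in\mathcal K$ and embeddings $\kappa_1:\mathbf A\to\mathbf D$, $\kappa_2:\mathbf B\to\mathbf D$ with $\kappa_1\circ\iota_1=\kappa_2\circ\iota_2$;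 it has APU if moreover $\mathbf D$ can always be chosen with domain $D=\kappa_1(A)\cup\kappa_2(B)$. $\mathcal K$ has the strong amalgamation property (SAP) if whenever $\mathbf A,\mathbf B,\mathbf C\in\mathcal K$, $\mathbf C\subseteq\mathbf A$, $\mathbf C\subseteq\mathbf B$ and $C=A\cap B$, there is $\mathbf D\in\mathcal K$ with $\mathbf A\subseteq\mathbf D$ and $\mathbf B\subseteq\mathbf D$; it has SAPU if moreover $\mathbf D$ can be chosen with $D=A\cup B$. For a binary relation symbol $R$, $\mathcal K$ has superSAP (resp. superSAPU) with respect to $R$ if, for every such triple, there is $\mathbf D$ witnessing SAP (resp. SAPU) such that for all $a\in A\setminus B$, $b\in B\setminus A$: if $a R^{\mathbf D} b$ then there is $c\in C$ with $a R^{\mathbf A} c$ and $c R^{\mathbf B} b$; and if $b R^{\mathbf D} a$ then there is $c\in C$ with $b R^{\mathbf B} c$ and $c R^{\mathbf A} a$. A theory has one of these properties if its class of models does; the empty class has all of them. -}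

module Defs where

open import Level using (Level; 0ℓ) renaming (suc to lsuc)
open import Data.Nat using (ℕ; zero; suc; _≤_)
open import Data.Fin using (Fin)
open import Data.Vec using (Vec; []; _∷_; lookup; map)
open import Data.Product using (Σ; Σ-syntax; ∃; ∃-syntax; _×_; _,_)
open import Data.Sum using (_⊎_)
open import Data.Empty using (⊥)
open import Data.Unit using (⊤)
open import Relation.Nullary using (¬_; Dec)
open import Relation.Binary.PropositionalEquality using (_≡_; subst; sym)
open import Function.Bundles using (_⇔_)

-- Classical metatheory (the paper works in ordinary classical mathematics)

Classical : Set₁
Classical = (P : Set) → Dec P

-- Languages.  Constant symbols are the function symbols of arity 0.

record Language : Set₁ where
  field
    FunSym   : Set
    funArity : FunSym → ℕ
    RelSym   : Set
    relArity : RelSym → ℕ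
open Language public

NoFunArity≥2 : Language → Set
NoFunArity≥2 L = (f : FunSym L) → funArity L f ≤ 1

-- Structures (equality is interpreted as identity _≡_ on the carrier)

record Structure (L : Language) : Set₁ where
  field
    Carrier : Set
    fun     : (f : FunSym L) → Vec Carrier (funArity L f) → Carrier
    rel     : (r : RelSym L) → Vec Carrier (relArity L r) → Set
open Structure public

relBin : {L : Language} (A : Structure L) (R : RelSym L) → relArity L R ≡ 2 →
         Carrier A → Carrier A → Set
relBin A R e x y = rel A R (subst (Vec (Carrier A)) (sym e) (x ∷ y ∷ []))

record Embedding {L : Language} (A B : Structure L) : Set where
  field
    emb       : Carrier A → Carrier B
    injective : ∀ x y → emb x ≡ emb y → x ≡ y
    pres-fun  : ∀ f xs → emb (fun A f xs) ≡ fun B f (map emb xs)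
    pres-rel  : ∀ r xs → rel A r xs ⇔ rel B r (map emb xs)
open Embedding public

Class : Language → Set₁
Class L = Structure L → Set

-- "closed under substructures" (classes are closed under isomorphism, so
-- this is: anything embeddable in a member is a member)
SubstructureClosed : {L : Language} → Class L → Set₁
SubstructureClosed {L} K = (A B : Structure L) → K B → Embedding A B → K A

module _ {L : Language} (K : Class L) where

  AP : Set₁
  AP = (A B C : Structure L) → K A → K B → K C →
       (ι₁ : Embedding C A) (ι₂ : Embedding C B) →
       Σ[ D ∈ Structure L ] K D × Σ[ κ₁ ∈ Embedding A D ] Σ[ κ₂ ∈ Embedding B D ]
         ((c : Carrier C) → emb κ₁ (emb ι₁ c) ≡ emb κ₂ (emb ι₂ c))

  APU : Set₁
  APU = (A B C : Structure L) → K A → K B → K C →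
        (ι₁ : Embedding C A) (ι₂ : Embedding C B) →
        Σ[ D ∈ Structure L ] K D × Σ[ κ₁ ∈ Embedding A D ] Σ[ κ₂ ∈ Embedding B D ]
          (((c : Carrier C) → emb κ₁ (emb ι₁ c) ≡ emb κ₂ (emb ι₂ c)) ×
           ((d : Carrier D) → (∃[ a ] emb κ₁ a ≡ d) ⊎ (∃[ b ] emb κ₂ b ≡ d)))

  -- strong amalgam: commuting square whose images meet exactly in the image of C
  -- (the embedding form of "A ⊆ D, B ⊆ D with C = A ∩ B")
  Strong : (A B C D : Structure L) → Embedding C A → Embedding C B →
           Embedding A D → Embedding B D → Set
  Strong A B C D ι₁ ι₂ κ₁ κ₂ =
    ((c : Carrier C) → emb κ₁ (emb ι₁ c) ≡ emb κ₂ (emb ι₂ c)) ×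
    ((a : Carrier A) (b : Carrier B) → emb κ₁ a ≡ emb κ₂ b →
       Σ[ c ∈ Carrier C ] (emb ι₁ c ≡ a × emb ι₂ c ≡ b))

  Union : (A B D : Structure L) → Embedding A D → Embedding B D → Set
  Union A B D κ₁ κ₂ =
    (d : Carrier D) → (∃[ a ] emb κ₁ a ≡ d) ⊎ (∃[ b ] emb κ₂ b ≡ d)

  Super : (R : RelSym L) (e : relArity L R ≡ 2) →
          (A B C D : Structure L) → Embedding C A → Embedding C B →
          Embedding A D → Embedding B D → Set
  Super R e A B C D ι₁ ι₂ κ₁ κ₂ =
    (a : Carrier A) (b : Carrier B) →
    ¬ (∃[ c ] emb ι₁ c ≡ a) → ¬ (∃[ c ] emb ι₂ c ≡ b) →
    (relBin D R e (emb κ₁ a) (emb κ₂ b) →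
       Σ[ c ∈ Carrier C ] (relBin A R e a (emb ι₁ c) × relBin B R e (emb ι₂ c) b)) ×
    (relBin D R e (emb κ₂ b) (emb κ₁ a) →
       Σ[ c ∈ Carrier C ] (relBin B R e b (emb ι₂ c) × relBin A R e (emb ι₁ c) a))

  SAP : Set₁
  SAP = (A B C : Structure L) → K A → K B → K C →
        (ι₁ : Embedding C A) (ι₂ : Embedding C B) →
        Σ[ D ∈ Structure L ] K D × Σ[ κ₁ ∈ Embedding A D ] Σ[ κ₂ ∈ Embedding B D ]
          Strong A B C D ι₁ ι₂ κ₁ κ₂

  SAPU : Set₁
  SAPU = (A B C : Structure L) → K A → K B → K C →
         (ι₁ : Embedding C A) (ι₂ : Embedding C B) →
         Σ[ D ∈ Structure L ] K D × Σ[ κ₁ ∈ Embedding A D ] Σ[ κ₂ ∈ Embedding B D ]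
           (Strong A B C D ι₁ ι₂ κ₁ κ₂ × Union A B D κ₁ κ₂)

  SuperSAP : (R : RelSym L) → relArity L R ≡ 2 → Set₁
  SuperSAP R e = (A B C : Structure L) → K A → K B → K C →
         (ι₁ : Embedding C A) (ι₂ : Embedding C B) →
         Σ[ D ∈ Structure L ] K D × Σ[ κ₁ ∈ Embedding A D ] Σ[ κ₂ ∈ Embedding B D ]
           (Strong A B C D ι₁ ι₂ κ₁ κ₂ × Super R e A B C D ι₁ ι₂ κ₁ κ₂)

  SuperSAPU : (R : RelSym L) → relArity L R ≡ 2 → Set₁
  SuperSAPU R e = (A B C : Structure L) → K A → K B → K C →
         (ι₁ : Embedding C A) (ι₂ : Embedding C B) →
         Σ[ D ∈ Structure L ] K D × Σ[ κ₁ ∈ Embedding A D ] Σ[ κ₂ ∈ Embedding B D ]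
           (Strong A B C D ι₁ ι₂ κ₁ κ₂ × Union A B D κ₁ κ₂ ×
            Super R e A B C D ι₁ ι₂ κ₁ κ₂)

AllStructures : (L : Language) → Class L
AllStructures L _ = ⊤

-- First-order syntax (de Bruijn variables; n = number of free variables)

module _ (L : Language) where

  data Term (n : ℕ) : Set where
    var : Fin n → Term n
    app : (f : FunSym L) → Vec (Term n) (funArity L f) → Term n

  data Formula (n : ℕ) : Set where
    ⊥'   : Formula n
    atom : (r : RelSym L) → Vec (Term n) (relArity L r) → Formula n
    _≐_  : Term n → Term n → Formula n
    ¬'_  : Formula n → Formula n
    _∧'_ : Formula n → Formula n → Formula n
    _∨'_ : Formula n → Formula n → Formula n
    _⇒'_ : Formula n → Formula n → Formula n
    ∀'_  : Formula (suc n) → Formula n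
    ∃'_  : Formula (suc n) → Formula n

  Sentence : Set
  Sentence = Formula 0

  Theory : Set₁
  Theory = Sentence → Set

module _ {L : Language} where

  data QuantifierFree {n : ℕ} : Formula L n → Set where
    qf-⊥    : QuantifierFree ⊥'
    qf-atom : ∀ r ts → QuantifierFree (atom r ts)
    qf-≐    : ∀ s t → QuantifierFree (s ≐ t)
    qf-¬    : ∀ {φ} → QuantifierFree φ → QuantifierFree (¬' φ)
    qf-∧    : ∀ {φ ψ} → QuantifierFree φ → QuantifierFree ψ → QuantifierFree (φ ∧' ψ)
    qf-∨    : ∀ {φ ψ} → QuantifierFree φ → QuantifierFree ψ → QuantifierFree (φ ∨' ψ)
    qf-⇒    : ∀ {φ ψ} → QuantifierFree φ → QuantifierFree ψ → QuantifierFree (φ ⇒' ψ)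

  data Universal : {n : ℕ} → Formula L n → Set where
    univ-qf : ∀ {n} {φ : Formula L n} → QuantifierFree φ → Universal φ
    univ-∀  : ∀ {n} {φ : Formula L (suc n)} → Universal φ → Universal (∀' φ)

  UniversalTheory : Theory L → Set
  UniversalTheory T = (φ : Sentence L) → T φ → Universal φ

  module _ (A : Structure L) where
    mutual
      evalT : {n : ℕ} → Vec (Carrier A) n → Term L n → Carrier A
      evalT ρ (var i)    = lookup ρ i
      evalT ρ (app f ts) = fun A f (evalTs ρ ts)

      evalTs : {n k : ℕ} → Vec (Carrier A) n → Vec (Term L n) k → Vec (Carrier A) k
      evalTs ρ []       = []
      evalTs ρ (t ∷ ts) = evalT ρ t ∷ evalTs ρ ts

    Sat : {n : ℕ} → Vec (Carrier A) n → Formula L n → Set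
    Sat ρ ⊥'         = ⊥
    Sat ρ (atom r ts) = rel A r (evalTs ρ ts)
    Sat ρ (s ≐ t)    = evalT ρ s ≡ evalT ρ t
    Sat ρ (¬' φ)     = ¬ Sat ρ φ
    Sat ρ (φ ∧' ψ)   = Sat ρ φ × Sat ρ ψ
    Sat ρ (φ ∨' ψ)   = Sat ρ φ ⊎ Sat ρ ψ
    Sat ρ (φ ⇒' ψ)   = Sat ρ φ → Sat ρ ψ
    Sat ρ (∀' φ)     = (x : Carrier A) → Sat (x ∷ ρ) φ
    Sat ρ (∃' φ)     = Σ[ x ∈ Carrier A ] Sat (x ∷ ρ) φ

  Mod : Theory L → Class L
  Mod T A = (φ : Sentence L) → T φ → Sat A [] φ

{-# OPTIONS --safe #-}

-- Universal sentences are reflected along embeddings, so (a) is an instance of (b).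
-- For (b), shrink an amalgam D of A and B to the union κ₁(A) ∪ κ₂(B): a function
-- of arity ≤ 1 applied to this set never mixes the two images, so the union is a
-- substructure of D, hence lies in K, and it inherits the commuting square, strongness
-- and the super condition from D. For (c), the free amalgam on A ⊔ (B ∖ C) interprets
-- a function or relation symbol through A or through B whenever all arguments lie in
-- one of them; mixed tuples are related to nothing, which gives the super condition.

module Submission where

open import Defs
open import Data.Nat using (ℕ; _≤_; s≤s)
open import Data.Vec using (Vec; []; _∷_; map)
open import Data.Vec.Properties using (map-∘; ∷-injective; lookup-map)
open import Data.Product using (Σ-syntax; ∃-syntax; _×_; _,_; proj₁; proj₂)
open import Data.Product.Function.NonDependent.Propositional using (_×-⇔_)
open import Data.Sum using (_⊎_; inj₁; inj₂)
open import Data.Sum.Function.Propositional using (_⊎-⇔_)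
open import Data.Sum.Properties using (inj₁-injective; inj₂-injective)
open import Data.Bool.Properties using (T-irrelevant)
open import Data.Empty using (⊥; ⊥-elim)
open import Data.Unit using (tt)
open import Function using (_∘_; id)
open import Function.Bundles using (Equivalence; _⇔_; mk⇔)
import Function.Properties.Equivalence as ⇔
open import Function.Related.TypeIsomorphisms using (→-cong-⇔; ¬-cong-⇔)
open import Relation.Nullary using (Dec; yes; no; ¬_)
open import Relation.Nullary.Decidable using (True; fromWitness; toWitness)
open import Relation.Binary.PropositionalEquality
  using (_≡_; refl; sym; trans; cong; cong₂; subst; module ≡-Reasoning)
open import Relation.Binary.PropositionalEquality.Properties using (subst-application′)

Image : {X Y : Set} → (X → Y) → Y → Set
Image g y = ∃[ x ] g x ≡ y

Image-map-pair : {X Y : Set} {g : X → Y} {y y′ : Y} →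
                 Image (map g) (y ∷ y′ ∷ []) → Image g y × Image g y′
Image-map-pair (x ∷ x′ ∷ [] , refl) = (x , refl) , (x′ , refl)

Image-map-subst : {X Y : Set} {g : X → Y} {m n : ℕ} (eq : m ≡ n) {ys : Vec Y m} →
                  Image (map g) (subst (Vec Y) eq ys) → Image (map g) ys
Image-map-subst refl = id

map-injective : {X Y : Set} {g : X → Y} → (∀ x y → g x ≡ g y → x ≡ y) →
                {n : ℕ} {xs ys : Vec X n} → map g xs ≡ map g ys → xs ≡ ys
map-injective g-inj {xs = []}     {[]}     _ = refl
map-injective g-inj {xs = x ∷ xs} {y ∷ ys} e =
  let ex , exs = ∷-injective e in cong₂ _∷_ (g-inj x y ex) (map-injective g-inj exs)

-- Membership is recorded as a Boolean witness, so that elements with equal first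
-- components are equal (subtype-≡) without function extensionality.
Subtype : Classical → {X : Set} → (X → Set) → Set
Subtype cl {X} P = Σ[ x ∈ X ] True (cl (P x))

subtype-≡ : (cl : Classical) {X : Set} {P : X → Set} {x y : Subtype cl P} →
            proj₁ x ≡ proj₁ y → x ≡ y
subtype-≡ cl {x = x , p} {y = .x , q} refl = cong (x ,_) (T-irrelevant p q)

module _ {L : Language} {A B : Structure L} (ι : Embedding A B) where

  mutual
    evalT-emb : ∀ {n} (ρ : Vec (Carrier A) n) (t : Term L n) →
                emb ι (evalT A ρ t) ≡ evalT B (map (emb ι) ρ) t
    evalT-emb ρ (var i)    = sym (lookup-map i (emb ι) ρ)
    evalT-emb ρ (app f ts) = trans (pres-fun ι f (evalTs A ρ ts)) (cong (fun B f) (evalTs-emb ρ ts))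

    evalTs-emb : ∀ {n k} (ρ : Vec (Carrier A) n) (ts : Vec (Term L n) k) →
                 map (emb ι) (evalTs A ρ ts) ≡ evalTs B (map (emb ι) ρ) ts
    evalTs-emb ρ []       = refl
    evalTs-emb ρ (t ∷ ts) = cong₂ _∷_ (evalT-emb ρ t) (evalTs-emb ρ ts)

  Sat-emb-qf : ∀ {n} {φ : Formula L n} → QuantifierFree φ → (ρ : Vec (Carrier A) n) →
               Sat A ρ φ ⇔ Sat B (map (emb ι) ρ) φ
  Sat-emb-qf qf-⊥ ρ = ⇔.refl
  Sat-emb-qf (qf-atom r ts) ρ =
    subst (λ v → rel A r (evalTs A ρ ts) ⇔ rel B r v) (evalTs-emb ρ ts) (pres-rel ι r _)
  Sat-emb-qf (qf-≐ s t) ρ = mk⇔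
    (λ e → trans (sym (evalT-emb ρ s)) (trans (cong (emb ι) e) (evalT-emb ρ t)))
    (λ e → injective ι _ _ (trans (evalT-emb ρ s) (trans e (sym (evalT-emb ρ t)))))
  Sat-emb-qf (qf-¬ p)   ρ = ¬-cong-⇔ (Sat-emb-qf p ρ)
  Sat-emb-qf (qf-∧ p q) ρ = Sat-emb-qf p ρ ×-⇔ Sat-emb-qf q ρ
  Sat-emb-qf (qf-∨ p q) ρ = Sat-emb-qf p ρ ⊎-⇔ Sat-emb-qf q ρ
  Sat-emb-qf (qf-⇒ p q) ρ = →-cong-⇔ (Sat-emb-qf p ρ) (Sat-emb-qf q ρ)

  Sat-emb-universal : ∀ {n} {φ : Formula L n} → Universal φ → (ρ : Vec (Carrier A) n) →
                      Sat B (map (emb ι) ρ) φ → Sat A ρ φ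
  Sat-emb-universal (univ-qf p) ρ = Equivalence.from (Sat-emb-qf p ρ)
  Sat-emb-universal (univ-∀ u)  ρ h x = Sat-emb-universal u (x ∷ ρ) (h (emb ι x))

  relBin-emb : (R : RelSym L) (e : relArity L R ≡ 2) (x y : Carrier A) →
               relBin A R e x y ⇔ relBin B R e (emb ι x) (emb ι y)
  relBin-emb R e x y =
    subst (λ v → relBin A R e x y ⇔ rel B R v)
          (sym (subst-application′ (Vec (Carrier A)) (λ _ → map (emb ι)) (sym e)))
          (pres-rel ι R _)

Mod-substructureClosed : {L : Language} (T : Theory L) → UniversalTheory T →
                         SubstructureClosed (Mod T)
Mod-substructureClosed T univ A B B⊨T ι φ φ∈T =
  Sat-emb-universal ι (univ φ φ∈T) [] (B⊨T φ φ∈T)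

module Induced (cl : Classical) {L : Language} (D : Structure L) (P : Carrier D → Set)
  (closed : ∀ f (xs : Vec (Subtype cl P) (funArity L f)) → P (fun D f (map proj₁ xs)))
  where

  induced : Structure L
  Carrier induced = Subtype cl P
  fun induced f xs = fun D f (map proj₁ xs) , fromWitness (closed f xs)
  rel induced r xs = rel D r (map proj₁ xs)

  inclusion : Embedding induced D
  emb inclusion = proj₁
  injective inclusion _ _ = subtype-≡ cl
  pres-fun inclusion _ _ = refl
  pres-rel inclusion _ _ = ⇔.refl

  corestrict : {X : Structure L} (κ : Embedding X D) → (∀ x → P (emb κ x)) →
               Embedding X induced
  emb (corestrict κ inP) x = emb κ x , fromWitness (inP x)
  injective (corestrict κ _) x y = injective κ x y ∘ cong proj₁
  pres-fun (corestrict κ inP) f xs = subtype-≡ cl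
    (trans (pres-fun κ f xs) (cong (fun D f) (map-∘ proj₁ (emb (corestrict κ inP)) xs)))
  pres-rel (corestrict {X} κ inP) r xs =
    subst (λ v → rel X r xs ⇔ rel D r v) (map-∘ proj₁ (emb (corestrict κ inP)) xs)
          (pres-rel κ r xs)

module UnionOfImages (cl : Classical) {L : Language} (ar : NoFunArity≥2 L)
  {A B D : Structure L} (κ₁ : Embedding A D) (κ₂ : Embedding B D) where

  InUnion : Carrier D → Set
  InUnion d = Image (emb κ₁) d ⊎ Image (emb κ₂) d

  InUnion-closed : ∀ {n} → n ≤ 1 →
    (gA : Vec (Carrier A) n → Carrier A) (gB : Vec (Carrier B) n → Carrier B)
    (gD : Vec (Carrier D) n → Carrier D) →
    (∀ as → emb κ₁ (gA as) ≡ gD (map (emb κ₁) as)) →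
    (∀ bs → emb κ₂ (gB bs) ≡ gD (map (emb κ₂) bs)) →
    (xs : Vec (Subtype cl InUnion) n) → InUnion (gD (map proj₁ xs))
  InUnion-closed _ gA gB gD hA hB [] = inj₁ (gA [] , hA [])
  InUnion-closed _ gA gB gD hA hB ((d , d∈) ∷ []) with toWitness d∈
  ... | inj₁ (a , refl) = inj₁ (gA (a ∷ []) , hA (a ∷ []))
  ... | inj₂ (b , refl) = inj₂ (gB (b ∷ []) , hB (b ∷ []))
  InUnion-closed (s≤s ()) gA gB gD hA hB (_ ∷ _ ∷ _)

  open Induced cl D InUnion
    (λ f → InUnion-closed (ar f) (fun A f) (fun B f) (fun D f) (pres-fun κ₁ f) (pres-fun κ₂ f))
    public

  κ₁∣ : Embedding A induced
  κ₁∣ = corestrict κ₁ (λ a → inj₁ (a , refl))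

  κ₂∣ : Embedding B induced
  κ₂∣ = corestrict κ₂ (λ b → inj₂ (b , refl))

  union : (d : Subtype cl InUnion) → Image (emb κ₁∣) d ⊎ Image (emb κ₂∣) d
  union (d , d∈) with toWitness d∈
  ... | inj₁ (a , e) = inj₁ (a , subtype-≡ cl e)
  ... | inj₂ (b , e) = inj₂ (b , subtype-≡ cl e)

  commute-induced : {C : Structure L} (ι₁ : Embedding C A) (ι₂ : Embedding C B) →
                    ((c : Carrier C) → emb κ₁ (emb ι₁ c) ≡ emb κ₂ (emb ι₂ c)) →
                    ((c : Carrier C) → emb κ₁∣ (emb ι₁ c) ≡ emb κ₂∣ (emb ι₂ c))
  commute-induced ι₁ ι₂ comm c = subtype-≡ cl (comm c)

  module _ {K : Class L} {C : Structure L} (ι₁ : Embedding C A) (ι₂ : Embedding C B) where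

    strong-induced : Strong K A B C D ι₁ ι₂ κ₁ κ₂ → Strong K A B C induced ι₁ ι₂ κ₁∣ κ₂∣
    strong-induced (comm , meet) = commute-induced ι₁ ι₂ comm , λ a b → meet a b ∘ cong proj₁

    super-induced : (R : RelSym L) (e : relArity L R ≡ 2) →
                    Super K R e A B C D ι₁ ι₂ κ₁ κ₂ →
                    Super K R e A B C induced ι₁ ι₂ κ₁∣ κ₂∣
    super-induced R e super a b a∉C b∉C =
      let forth , back = super a b a∉C b∉C
      in forth ∘ Equivalence.to (relBin-emb inclusion R e _ _) ,
         back ∘ Equivalence.to (relBin-emb inclusion R e _ _)

module _ (cl : Classical) {L : Language} (ar : NoFunArity≥2 L) (K : Class L)
         (closed : SubstructureClosed K) where

  APU⇔AP : APU K ⇔ AP K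
  APU⇔AP = mk⇔ forget shrink
    where
    forget : APU K → AP K
    forget apu A B C kA kB kC ι₁ ι₂ =
      let D , kD , κ₁ , κ₂ , comm , _ = apu A B C kA kB kC ι₁ ι₂ in D , kD , κ₁ , κ₂ , comm
    shrink : AP K → APU K
    shrink ap A B C kA kB kC ι₁ ι₂ =
      let D , kD , κ₁ , κ₂ , comm = ap A B C kA kB kC ι₁ ι₂
          open UnionOfImages cl ar κ₁ κ₂
      in induced , closed induced D kD inclusion , κ₁∣ , κ₂∣ ,
         commute-induced ι₁ ι₂ comm , union

  SAPU⇔SAP : SAPU K ⇔ SAP K
  SAPU⇔SAP = mk⇔ forget shrink
    where
    forget : SAPU K → SAP K
    forget sapu A B C kA kB kC ι₁ ι₂ =
      let D , kD , κ₁ , κ₂ , strong , _ = sapu A B C kA kB kC ι₁ ι₂ in D , kD , κ₁ , κ₂ , strong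
    shrink : SAP K → SAPU K
    shrink sap A B C kA kB kC ι₁ ι₂ =
      let D , kD , κ₁ , κ₂ , strong = sap A B C kA kB kC ι₁ ι₂
          open UnionOfImages cl ar κ₁ κ₂
      in induced , closed induced D kD inclusion , κ₁∣ , κ₂∣ ,
         strong-induced {K = K} ι₁ ι₂ strong , union

  SuperSAPU⇔SuperSAP : (R : RelSym L) (e : relArity L R ≡ 2) →
                       SuperSAPU K R e ⇔ SuperSAP K R e
  SuperSAPU⇔SuperSAP R e = mk⇔ forget shrink
    where
    forget : SuperSAPU K R e → SuperSAP K R e
    forget ssapu A B C kA kB kC ι₁ ι₂ =
      let D , kD , κ₁ , κ₂ , strong , _ , super = ssapu A B C kA kB kC ι₁ ι₂
      in D , kD , κ₁ , κ₂ , strong , super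
    shrink : SuperSAP K R e → SuperSAPU K R e
    shrink ssap A B C kA kB kC ι₁ ι₂ =
      let D , kD , κ₁ , κ₂ , strong , super = ssap A B C kA kB kC ι₁ ι₂
          open UnionOfImages cl ar κ₁ κ₂
      in induced , closed induced D kD inclusion , κ₁∣ , κ₂∣ ,
         strong-induced {K = K} ι₁ ι₂ strong , union , super-induced {K = K} ι₁ ι₂ R e super

module FreeAmalgam (cl : Classical) {L : Language} {A B C : Structure L}
  (ι₁ : Embedding C A) (ι₂ : Embedding C B) where

  Amalgam : Set
  Amalgam = Carrier A ⊎ Subtype cl (λ b → ¬ Image (emb ι₂) b)

  glue : (b : Carrier B) → Dec (Image (emb ι₂) b) → Amalgam
  glue b (yes (c , _)) = inj₁ (emb ι₁ c)
  glue b (no b∉C)      = inj₂ (b , fromWitness b∉C)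

  fromB : Carrier B → Amalgam
  fromB b = glue b (cl (Image (emb ι₂) b))

  fromB-ι₂ : (c : Carrier C) → fromB (emb ι₂ c) ≡ inj₁ (emb ι₁ c)
  fromB-ι₂ c with cl (Image (emb ι₂) (emb ι₂ c))
  ... | yes (c′ , e) = cong (inj₁ ∘ emb ι₁) (injective ι₂ c′ c e)
  ... | no c∉C       = ⊥-elim (c∉C (c , refl))

  fromB-new : (b : Carrier B) (b∉C : True (cl (¬ Image (emb ι₂) b))) → fromB b ≡ inj₂ (b , b∉C)
  fromB-new b b∉C with cl (Image (emb ι₂) b)
  ... | yes b∈C = ⊥-elim (toWitness b∉C b∈C)
  ... | no _    = cong inj₂ (subtype-≡ cl refl)

  fromB-meets-A : (a : Carrier A) (b : Carrier B) → inj₁ a ≡ fromB b →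
                  Σ[ c ∈ Carrier C ] (emb ι₁ c ≡ a × emb ι₂ c ≡ b)
  fromB-meets-A a b e with cl (Image (emb ι₂) b)
  fromB-meets-A a b e  | yes (c , ι₂c≡b) = c , sym (inj₁-injective e) , ι₂c≡b
  fromB-meets-A a b () | no _

  fromB-injective : (b b′ : Carrier B) → fromB b ≡ fromB b′ → b ≡ b′
  fromB-injective b b′ e with cl (Image (emb ι₂) b) | cl (Image (emb ι₂) b′)
  fromB-injective b b′ e  | yes (c , refl) | yes (c′ , refl) =
    cong (emb ι₂) (injective ι₁ c c′ (inj₁-injective e))
  fromB-injective b b′ () | yes _ | no _
  fromB-injective b b′ () | no _  | yes _
  fromB-injective b b′ e  | no _  | no _ = cong proj₁ (inj₂-injective e)

  common-part : ∀ {n} (as : Vec (Carrier A) n) (bs : Vec (Carrier B) n) →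
                map inj₁ as ≡ map fromB bs →
                Σ[ cs ∈ Vec (Carrier C) n ] (map (emb ι₁) cs ≡ as × map (emb ι₂) cs ≡ bs)
  common-part []       []       _ = [] , refl , refl
  common-part (a ∷ as) (b ∷ bs) e =
    let e-head , e-tail = ∷-injective e
        c , ι₁c≡a , ι₂c≡b = fromB-meets-A a b e-head
        cs , ι₁cs≡as , ι₂cs≡bs = common-part as bs e-tail
    in c ∷ cs , cong₂ _∷_ ι₁c≡a ι₁cs≡as , cong₂ _∷_ ι₂c≡b ι₂cs≡bs

  InA InB : ∀ {n} → Vec Amalgam n → Set
  InA = Image (map inj₁)
  InB = Image (map fromB)

  -- A tuple meeting both A ∖ C and B ∖ C is sent to one of its own entries; the
  -- choice is irrelevant to the embeddings.
  apply : ∀ {n} → (Vec (Carrier A) n → Carrier A) → (Vec (Carrier B) n → Carrier B) →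
          (xs : Vec Amalgam n) → Dec (InA xs) → Dec (InB xs) → Amalgam
  apply gA gB _        (yes (as , _)) _              = inj₁ (gA as)
  apply gA gB _        (no _)         (yes (bs , _)) = fromB (gB bs)
  apply gA gB []       (no ∉A)        (no _)         = ⊥-elim (∉A ([] , refl))
  apply gA gB (x ∷ _)  (no _)         (no _)         = x

  holds : ∀ {n} {xs : Vec Amalgam n} →
          (Vec (Carrier A) n → Set) → (Vec (Carrier B) n → Set) → Dec (InA xs) → Dec (InB xs) → Set
  holds PA PB (yes (as , _)) _              = PA as
  holds PA PB (no _)         (yes (bs , _)) = PB bs
  holds PA PB (no _)         (no _)         = ⊥

  amalgam : Structure L
  Carrier amalgam = Amalgam
  fun amalgam f xs = apply (fun A f) (fun B f) xs (cl (InA xs)) (cl (InB xs))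
  rel amalgam r xs = holds (rel A r) (rel B r) (cl (InA xs)) (cl (InB xs))

  apply-A : ∀ {n} gA gB (as : Vec (Carrier A) n) dA dB →
            inj₁ (gA as) ≡ apply gA gB (map inj₁ as) dA dB
  apply-A gA gB as (yes (as′ , e)) _ =
    cong (inj₁ ∘ gA) (map-injective (λ _ _ → inj₁-injective) (sym e))
  apply-A gA gB as (no ∉A)         _ = ⊥-elim (∉A (as , refl))

  apply-B : ∀ f (bs : Vec (Carrier B) (funArity L f)) dA dB →
            fromB (fun B f bs) ≡ apply (fun A f) (fun B f) (map fromB bs) dA dB
  apply-B f bs (yes (as , e)) _ with common-part as bs e
  ... | cs , refl , refl = begin
    fromB (fun B f (map (emb ι₂) cs))  ≡⟨ cong fromB (pres-fun ι₂ f cs) ⟨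
    fromB (emb ι₂ (fun C f cs))        ≡⟨ fromB-ι₂ (fun C f cs) ⟩
    inj₁ (emb ι₁ (fun C f cs))         ≡⟨ cong inj₁ (pres-fun ι₁ f cs) ⟩
    inj₁ (fun A f (map (emb ι₁) cs))   ∎
    where open ≡-Reasoning
  apply-B f bs (no _) (yes (bs′ , e)) =
    cong (fromB ∘ fun B f) (map-injective fromB-injective (sym e))
  apply-B f bs (no _) (no ∉B)         = ⊥-elim (∉B (bs , refl))

  holds-A : ∀ {n} PA PB (as : Vec (Carrier A) n) dA dB →
            PA as ⇔ holds {xs = map inj₁ as} PA PB dA dB
  holds-A PA PB as (yes (as′ , e)) _ with map-injective (λ _ _ → inj₁-injective) e
  ... | refl = ⇔.refl
  holds-A PA PB as (no ∉A) _ = ⊥-elim (∉A (as , refl))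

  holds-B : ∀ r (bs : Vec (Carrier B) (relArity L r)) dA dB →
            rel B r bs ⇔ holds {xs = map fromB bs} (rel A r) (rel B r) dA dB
  holds-B r bs (yes (as , e)) _ with common-part as bs e
  ... | cs , refl , refl = ⇔.trans (⇔.sym (pres-rel ι₂ r cs)) (pres-rel ι₁ r cs)
  holds-B r bs (no _) (yes (bs′ , e)) with map-injective fromB-injective e
  ... | refl = ⇔.refl
  holds-B r bs (no _) (no ∉B) = ⊥-elim (∉B (bs , refl))

  holds-mixed : ∀ {n} {xs : Vec Amalgam n} PA PB → ¬ InA xs → ¬ InB xs →
                (dA : Dec (InA xs)) (dB : Dec (InB xs)) → ¬ holds PA PB dA dB
  holds-mixed PA PB ∉A ∉B (yes x∈A) _         = ⊥-elim (∉A x∈A)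
  holds-mixed PA PB ∉A ∉B (no _)    (yes x∈B) = ⊥-elim (∉B x∈B)
  holds-mixed PA PB ∉A ∉B (no _)    (no _)    = id

  κ₁ : Embedding A amalgam
  emb κ₁ = inj₁
  injective κ₁ _ _ = inj₁-injective
  pres-fun κ₁ f as = apply-A (fun A f) (fun B f) as (cl _) (cl _)
  pres-rel κ₁ r as = holds-A (rel A r) (rel B r) as (cl _) (cl _)

  κ₂ : Embedding B amalgam
  emb κ₂ = fromB
  injective κ₂ = fromB-injective
  pres-fun κ₂ f bs = apply-B f bs (cl _) (cl _)
  pres-rel κ₂ r bs = holds-B r bs (cl _) (cl _)

  strong : Strong (AllStructures L) A B C amalgam ι₁ ι₂ κ₁ κ₂
  strong = (λ c → sym (fromB-ι₂ c)) , fromB-meets-A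

  union : Union (AllStructures L) A B amalgam κ₁ κ₂
  union (inj₁ a)         = inj₁ (a , refl)
  union (inj₂ (b , b∉C)) = inj₂ (b , fromB-new b b∉C)

  unrelated : (R : RelSym L) (e : relArity L R ≡ 2) (x y : Amalgam) →
              ¬ InA (x ∷ y ∷ []) → ¬ InB (x ∷ y ∷ []) → ¬ relBin amalgam R e x y
  unrelated R e x y ∉A ∉B =
    holds-mixed (rel A R) (rel B R) (∉A ∘ Image-map-subst (sym e)) (∉B ∘ Image-map-subst (sym e))
                (cl _) (cl _)

  fromB-outside-A : {b : Carrier B} → ¬ Image (emb ι₂) b → ¬ Image inj₁ (fromB b)
  fromB-outside-A {b} b∉C (a , e) = let c , _ , ι₂c≡b = fromB-meets-A a b e in b∉C (c , ι₂c≡b)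

  inj₁-outside-B : {a : Carrier A} → ¬ Image (emb ι₁) a → ¬ Image fromB (inj₁ a)
  inj₁-outside-B {a} a∉C (b , e) = let c , ι₁c≡a , _ = fromB-meets-A a b (sym e) in a∉C (c , ι₁c≡a)

  super : (R : RelSym L) (e : relArity L R ≡ 2) →
          Super (AllStructures L) R e A B C amalgam ι₁ ι₂ κ₁ κ₂
  super R e a b a∉C b∉C =
    ⊥-elim ∘ unrelated R e (inj₁ a) (fromB b)
      (fromB-outside-A b∉C ∘ proj₂ ∘ Image-map-pair)
      (inj₁-outside-B a∉C ∘ proj₁ ∘ Image-map-pair) ,
    ⊥-elim ∘ unrelated R e (fromB b) (inj₁ a)
      (fromB-outside-A b∉C ∘ proj₁ ∘ Image-map-pair)
      (inj₁-outside-B a∉C ∘ proj₂ ∘ Image-map-pair)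

AllStructures-SAPU : Classical → (L : Language) → SAPU (AllStructures L)
AllStructures-SAPU cl L A B C _ _ _ ι₁ ι₂ = amalgam , tt , κ₁ , κ₂ , strong , union
  where open FreeAmalgam cl ι₁ ι₂

AllStructures-SuperSAPU : Classical → (L : Language) (R : RelSym L) (e : relArity L R ≡ 2) →
                          SuperSAPU (AllStructures L) R e
AllStructures-SuperSAPU cl L R e A B C _ _ _ ι₁ ι₂ =
  amalgam , tt , κ₁ , κ₂ , strong , union , super R e
  where open FreeAmalgam cl ι₁ ι₂

mainTheorem1 : Classical →
    -- (a) universal theories
    ((L : Language) → NoFunArity≥2 L → (T : Theory L) → UniversalTheory T →
      (APU (Mod T) ⇔ AP (Mod T)) ×
      (SAPU (Mod T) ⇔ SAP (Mod T)) ×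
      ((R : RelSym L) (e : relArity L R ≡ 2) →
        SuperSAPU (Mod T) R e ⇔ SuperSAP (Mod T) R e)) ×
    -- (b) classes closed under substructures
    ((L : Language) → NoFunArity≥2 L → (K : Class L) → SubstructureClosed K →
      (APU K ⇔ AP K) ×
      (SAPU K ⇔ SAP K) ×
      ((R : RelSym L) (e : relArity L R ≡ 2) →
        SuperSAPU K R e ⇔ SuperSAP K R e)) ×
    -- (c) the class of all structures
    ((L : Language) →
      SAPU (AllStructures L) ×
      ((R : RelSym L) (e : relArity L R ≡ 2) → SuperSAPU (AllStructures L) R e))
mainTheorem1 cl =
  (λ L ar T univ → amalgamation-iffs ar (Mod T) (Mod-substructureClosed T univ)) ,
  (λ L → amalgamation-iffs) ,
  (λ L → AllStructures-SAPU cl L , AllStructures-SuperSAPU cl L)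
  where
  amalgamation-iffs : ∀ {L} → NoFunArity≥2 L → ∀ K → SubstructureClosed K →
          (APU K ⇔ AP K) × (SAPU K ⇔ SAP K) ×
          ((R : RelSym L) (e : relArity L R ≡ 2) → SuperSAPU K R e ⇔ SuperSAP K R e)
  amalgamation-iffs ar K closed =
    APU⇔AP cl ar K closed , SAPU⇔SAP cl ar K closed , SuperSAPU⇔SuperSAP cl ar K closed
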